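{- Let $k\ge3$ be an integer. Then $\bar\alpha(x)\le\bar\alpha(x+2F_{k-2})$ for each $x\in\mathbb{N}\cap[0,F_{k-1}+F_{k-3}]$, with equality if $x\notin\overline{\mathcal{F}}$ and $x\ne F_{k-1}+F_{k-3}$.
   Context: Fibonacci numbers: $F_{ -1}=0$, $F_0=1$, $F_{i+2}=F_{i+1}+F_i$; $\overline{\mathcal{F}}=\{F_i: i\ge-1\}$. Define $\bar\iota:\mathbb{N}\to\mathbb{N}$ by $\bar\iota(x)=x$ if $x\in\overline{\mathcal{F}}$, and $\bar\iota(x)=x-2F_{i-2}$ if $F_i<x<F_{i+1}$ for an integer $i\ge3$. Define $\bar\alpha(x)=\lim_{k\to\infty}\bar\iota^k(x)$ (the iterates are eventually constant). -}

module Defs where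

open import Data.Nat using (ℕ; zero; suc; _+_; _*_; _∸_; _≤_; _<_; _<ᵇ_)
open import Data.Nat.Properties using (_≟_)
open import Data.Bool using (Bool; true; false; if_then_else_; _∨_)
open import Data.Product using (∃; _×_)
open import Relation.Binary.PropositionalEquality using (_≡_)
open import Relation.Nullary.Decidable using (⌊_⌋)

-- Shifted Fibonacci: Fib n = F_{n-1} in the paper's indexing
-- (F_{-1} = 0, F_0 = 1, F_{i+2} = F_{i+1} + F_i).
Fib : ℕ → ℕ
Fib zero = 0
Fib (suc zero) = 1
Fib (suc (suc n)) = Fib (suc n) + Fib n

-- The paper's F_i for i ≥ -1, written F' i meaning F_{i-1}; we only use Fib.
-- Membership in \bar{F} = { F_i : i ≥ -1 } = { Fib n : n ∈ ℕ }.
InFbar : ℕ → Set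
InFbar x = ∃ λ n → Fib n ≡ x

-- Boolean test: is x = Fib n for some n ≤ b ?  (Fib (x+1) ≥ x so b = x + 1 suffices)
isFibUpTo : ℕ → ℕ → Bool
isFibUpTo x zero = ⌊ Fib zero ≟ x ⌋
isFibUpTo x (suc b) = ⌊ Fib (suc b) ≟ x ⌋ ∨ isFibUpTo x b

isFib : ℕ → Bool
isFib x = isFibUpTo x (suc x)

findIdx : ℕ → ℕ → ℕ → ℕ
findIdx x n zero = n
findIdx x n (suc fuel) = if x <ᵇ Fib (suc n) then n else findIdx x (suc n) fuel

-- For x ∉ \bar{F}: the n with Fib n < x < Fib (suc n), i.e. F_i < x < F_{i+1} with i = n - 1.
-- Then F_{i-2} = Fib (n ∸ 2).
ιbar : ℕ → ℕ
ιbar x = if isFib x then x else x ∸ 2 * Fib (findIdx x 0 (x + 2) ∸ 2)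

iter : (ℕ → ℕ) → ℕ → ℕ → ℕ
iter f zero x = x
iter f (suc k) x = f (iter f k x)

αbarIs : ℕ → ℕ → Set
αbarIs x y = ∃ λ K → ∀ k → K ≤ k → iter ιbar k x ≡ y

-- Write s = 2F_{k-2} and c = F_{k-1} + F_{k-3}. Since ι̅ never increases its argument and fixes
-- the Fibonacci numbers, ᾱ(y) ≤ y, ᾱ(F_i) = F_i and ᾱ(y) = ᾱ(ι̅ y). For x = 0 the claim is
-- trivial; for 0 < x ≤ c the point x + s lies in (F_{k-1}, F_{k+1}] and
--   x < F_{k-3}:      x + s ∈ (F_{k-1}, F_k), so ι̅(x + s) = x + 2F_{k-4}: the claim for k - 2;
--   x = F_{k-3}:      x + s = F_k, so ᾱ(x) ≤ x ≤ F_k = ᾱ(x + s);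
--   F_{k-3} < x < c:  x + s ∈ (F_k, F_{k+1}), so ι̅(x + s) = x;
--   x = c:            x + s = F_{k+1}, as in the second case.
-- Below n = k - 3, so that F_{k+j} = Fib (4 + n + j).

module Submission where

open import Defs
open import Data.Nat using (ℕ; zero; suc; _+_; _*_; _∸_; _≤_; _<_; _≤′_; ≤′-refl; ≤′-step; _<ᵇ_; z≤n; s≤s; _≤?_)
open import Data.Nat.Properties
open import Data.Nat.Tactic.RingSolver using (solve-∀)
open import Data.Bool using (true; false; _∨_)
open import Data.Bool.Properties using (∨-zeroʳ; T-≡; T-not-≡)
open import Data.Product using (_×_; _,_)
open import Data.Sum using (inj₁; inj₂)
open import Data.Empty using (⊥-elim)
open import Function using (_∘′_)
open import Function.Bundles using (Equivalence)
open import Relation.Nullary using (¬_; yes; no)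
open import Relation.Nullary.Decidable using (fromWitness; fromWitnessFalse)
open import Relation.Binary using (tri<; tri≈; tri>)
open import Relation.Binary.PropositionalEquality using (_≡_; _≢_; refl; sym; trans; cong; subst; module ≡-Reasoning)

Fib[n]≤Fib[1+n] : ∀ n → Fib n ≤ Fib (suc n)
Fib[n]≤Fib[1+n] zero    = z≤n
Fib[n]≤Fib[1+n] (suc n) = m≤m+n (Fib (suc n)) (Fib n)

Fib-mono-≤ : ∀ {m n} → m ≤ n → Fib m ≤ Fib n
Fib-mono-≤ = mono′ ∘′ ≤⇒≤′
  where
  mono′ : ∀ {m n} → m ≤′ n → Fib m ≤ Fib n
  mono′ ≤′-refl                    = ≤-refl
  mono′ {n = suc n} (≤′-step m≤′n) = ≤-trans (mono′ m≤′n) (Fib[n]≤Fib[1+n] n)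

0<Fib[1+n] : ∀ n → 0 < Fib (suc n)
0<Fib[1+n] zero    = s≤s z≤n
0<Fib[1+n] (suc n) = ≤-trans (0<Fib[1+n] n) (m≤m+n _ _)

n≤1+Fib[n] : ∀ n → n ≤ suc (Fib n)
n≤1+Fib[n] zero                = z≤n
n≤1+Fib[n] (suc zero)          = s≤s z≤n
n≤1+Fib[n] (suc (suc zero))    = s≤s (s≤s z≤n)
n≤1+Fib[n] (suc (suc (suc n))) = begin
  suc (suc (suc n))                  ≤⟨ s≤s (n≤1+Fib[n] (suc (suc n))) ⟩
  suc (suc (Fib (suc (suc n))))      ≡⟨ cong suc (+-comm 1 (Fib (suc (suc n)))) ⟩
  suc (Fib (suc (suc n)) + 1)        ≤⟨ s≤s (+-monoʳ-≤ (Fib (suc (suc n))) (0<Fib[1+n] n)) ⟩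
  suc (Fib (suc (suc n)) + Fib (suc n)) ∎
  where open ≤-Reasoning

isFibUpTo-Fib : ∀ {j b} → j ≤ b → isFibUpTo (Fib j) b ≡ true
isFibUpTo-Fib {b = zero} z≤n = refl
isFibUpTo-Fib {j} {suc b} j≤1+b with m≤n⇒m<n∨m≡n j≤1+b
... | inj₂ refl      = cong (_∨ isFibUpTo (Fib j) b) (Equivalence.to T-≡ (fromWitness refl))
... | inj₁ (s≤s j≤b) rewrite isFibUpTo-Fib j≤b = ∨-zeroʳ _

isFibUpTo-nonFib : ∀ {x} b → (∀ j → Fib j ≢ x) → isFibUpTo x b ≡ false
isFibUpTo-nonFib {x} zero    x∉F = Equivalence.to T-not-≡ (fromWitnessFalse (x∉F zero))
isFibUpTo-nonFib {x} (suc b) x∉F =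
  trans (cong (_∨ isFibUpTo x b) (Equivalence.to T-not-≡ (fromWitnessFalse (x∉F (suc b))))) (isFibUpTo-nonFib b x∉F)

Fib≢-between : ∀ m {y} → Fib m < y → y < Fib (suc m) → ∀ j → Fib j ≢ y
Fib≢-between m Fm<y y<Fm+1 j refl with j ≤? m
... | yes j≤m = <⇒≱ Fm<y (Fib-mono-≤ j≤m)
... | no  j≰m = <⇒≱ y<Fm+1 (Fib-mono-≤ (≰⇒> j≰m))

findIdx-≡ : ∀ {x} n d {fuel} → d ≤ fuel → Fib (n + d) ≤ x → x < Fib (suc (n + d)) → findIdx x n fuel ≡ n + d
findIdx-≡ {x} n zero {zero} _ _ _ = sym (+-identityʳ n)
findIdx-≡ {x} n zero {suc fuel} _ _ x<F rewrite +-identityʳ n | Equivalence.to T-≡ (<⇒<ᵇ x<F) = refl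
findIdx-≡ {x} n (suc d) {suc fuel} (s≤s d≤fuel) F≤x x<F rewrite +-suc n d with x <ᵇ Fib (suc n) in eq
... | true  = ⊥-elim (<⇒≱ (<ᵇ⇒< x (Fib (suc n)) (Equivalence.from T-≡ eq)) (≤-trans (Fib-mono-≤ (s≤s (m≤m+n n d))) F≤x))
... | false = findIdx-≡ (suc n) d d≤fuel F≤x x<F

ιbar-between : ∀ m {y} → Fib m < y → y < Fib (suc m) → ιbar y ≡ y ∸ 2 * Fib (m ∸ 2)
ιbar-between m {y} Fm<y y<Fm+1
  rewrite isFibUpTo-nonFib (suc y) (Fib≢-between m Fm<y y<Fm+1)
        | findIdx-≡ 0 m (≤-trans (n≤1+Fib[n] m) (≤-trans Fm<y (m≤m+n y 2))) (<⇒≤ Fm<y) y<Fm+1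
        = refl

ιbar-Fib : ∀ m → ιbar (Fib m) ≡ Fib m
ιbar-Fib m rewrite isFibUpTo-Fib (n≤1+Fib[n] m) = refl

ιbar-≤ : ∀ x → ιbar x ≤ x
ιbar-≤ x with isFib x
... | true  = ≤-refl
... | false = m∸n≤m x (2 * Fib (findIdx x 0 (x + 2) ∸ 2))

iter-fixed : ∀ {f : ℕ → ℕ} {x} → f x ≡ x → ∀ k → iter f k x ≡ x
iter-fixed     fx≡x zero    = refl
iter-fixed {f} fx≡x (suc k) = trans (cong f (iter-fixed fx≡x k)) fx≡x

iter-suc-inner : ∀ (f : ℕ → ℕ) k x → iter f k (f x) ≡ iter f (suc k) x
iter-suc-inner f zero    x = refl
iter-suc-inner f (suc k) x = cong f (iter-suc-inner f k x)

iter-deflationary : ∀ {f : ℕ → ℕ} → (∀ x → f x ≤ x) → ∀ k x → iter f k x ≤ x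
iter-deflationary f≤id zero    x = ≤-refl
iter-deflationary f≤id (suc k) x = ≤-trans (f≤id _) (iter-deflationary f≤id k x)

αbarIs-unique : ∀ {x a b} → αbarIs x a → αbarIs x b → a ≡ b
αbarIs-unique (K , h) (L , g) = trans (sym (h (K + L) (m≤m+n K L))) (g (K + L) (m≤n+m L K))

αbarIs-≤ : ∀ {x a} → αbarIs x a → a ≤ x
αbarIs-≤ {x} (K , h) = subst (_≤ x) (h K ≤-refl) (iter-deflationary ιbar-≤ K x)

αbarIs-Fib : ∀ m → αbarIs (Fib m) (Fib m)
αbarIs-Fib m = 0 , λ k _ → iter-fixed (ιbar-Fib m) k

αbarIs-ιbar : ∀ {x a} → αbarIs x a → αbarIs (ιbar x) a
αbarIs-ιbar {x} (K , h) = K , λ k K≤k → trans (iter-suc-inner ιbar k x) (h (suc k) (m≤n⇒m≤1+n K≤k))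

infix 4 _≤α_ _≡α_

_≤α_ : ℕ → ℕ → Set
x ≤α y = ∀ {a b} → αbarIs x a → αbarIs y b → a ≤ b

_≡α_ : ℕ → ℕ → Set
x ≡α y = ∀ {a b} → αbarIs x a → αbarIs y b → a ≡ b

≡α-refl : ∀ {x} → x ≡α x
≡α-refl = αbarIs-unique

≡α⇒≤α : ∀ {x y} → x ≡α y → x ≤α y
≡α⇒≤α x≡αy αx αy = ≤-reflexive (x≡αy αx αy)

≤α-Fib : ∀ {x y} m → y ≡ Fib m → x ≤ y → x ≤α y
≤α-Fib m refl x≤y αx αy = ≤-trans (αbarIs-≤ αx) (≤-trans x≤y (≤-reflexive (αbarIs-unique (αbarIs-Fib m) αy)))

≤α-ιbarʳ : ∀ {x y z} → ιbar y ≡ z → x ≤α z → x ≤α y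
≤α-ιbarʳ refl x≤αz αx αy = x≤αz αx (αbarIs-ιbar αy)

≡α-ιbarʳ : ∀ {x y z} → ιbar y ≡ z → x ≡α z → x ≡α y
≡α-ιbarʳ refl x≡αz αx αy = x≡αz αx (αbarIs-ιbar αy)

Fib[1+n]+2*Fib[2+n]≡Fib[4+n] : ∀ n → Fib (1 + n) + 2 * Fib (2 + n) ≡ Fib (4 + n)
Fib[1+n]+2*Fib[2+n]≡Fib[4+n] n = identity (Fib n) (Fib (1 + n))
  where
  identity : ∀ a b → b + 2 * (b + a) ≡ ((b + a) + b) + (b + a)
  identity = solve-∀

Fib[3+n]+Fib[1+n]+2*Fib[2+n]≡Fib[5+n] : ∀ n → Fib (3 + n) + Fib (1 + n) + 2 * Fib (2 + n) ≡ Fib (5 + n)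
Fib[3+n]+Fib[1+n]+2*Fib[2+n]≡Fib[5+n] n = identity (Fib n) (Fib (1 + n))
  where
  identity : ∀ a b → ((b + a) + b) + b + 2 * (b + a) ≡ (((b + a) + b) + (b + a)) + ((b + a) + b)
  identity = solve-∀

m+2*Fib[2+n]≡m+2*Fib[n]+2*Fib[1+n] : ∀ m n → m + 2 * Fib (2 + n) ≡ m + 2 * Fib n + 2 * Fib (1 + n)
m+2*Fib[2+n]≡m+2*Fib[n]+2*Fib[1+n] m n = identity m (Fib n) (Fib (1 + n))
  where
  identity : ∀ m a b → m + 2 * (b + a) ≡ m + 2 * a + 2 * b
  identity = solve-∀

Fib[3+n]≤2*Fib[2+n] : ∀ n → Fib (3 + n) ≤ 2 * Fib (2 + n)
Fib[3+n]≤2*Fib[2+n] n = begin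
  Fib (2 + n) + Fib (1 + n)  ≤⟨ +-monoʳ-≤ (Fib (2 + n)) (Fib[n]≤Fib[1+n] (1 + n)) ⟩
  Fib (2 + n) + Fib (2 + n)  ≡⟨ cong (Fib (2 + n) +_) (sym (+-identityʳ (Fib (2 + n)))) ⟩
  2 * Fib (2 + n)            ∎
  where open ≤-Reasoning

ιbar-shift-below : ∀ n {x} → 0 < x → x < Fib (1 + n) → ιbar (x + 2 * Fib (2 + n)) ≡ x + 2 * Fib n
ιbar-shift-below n {x} 0<x x<F = begin
  ιbar (x + 2 * Fib (2 + n))                    ≡⟨ ιbar-between (3 + n) lower upper ⟩
  x + 2 * Fib (2 + n) ∸ 2 * Fib (1 + n)         ≡⟨ cong (_∸ 2 * Fib (1 + n)) (m+2*Fib[2+n]≡m+2*Fib[n]+2*Fib[1+n] x n) ⟩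
  x + 2 * Fib n + 2 * Fib (1 + n) ∸ 2 * Fib (1 + n) ≡⟨ m+n∸n≡m (x + 2 * Fib n) (2 * Fib (1 + n)) ⟩
  x + 2 * Fib n                                 ∎
  where
  open ≡-Reasoning
  lower : Fib (3 + n) < x + 2 * Fib (2 + n)
  lower = ≤-<-trans (Fib[3+n]≤2*Fib[2+n] n) (m<n+m (2 * Fib (2 + n)) 0<x)
  upper : x + 2 * Fib (2 + n) < Fib (4 + n)
  upper = subst (x + 2 * Fib (2 + n) <_) (Fib[1+n]+2*Fib[2+n]≡Fib[4+n] n) (+-monoˡ-< (2 * Fib (2 + n)) x<F)

ιbar-shift-above : ∀ n {x} → Fib (1 + n) < x → x < Fib (3 + n) + Fib (1 + n) → ιbar (x + 2 * Fib (2 + n)) ≡ x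
ιbar-shift-above n {x} F<x x<c = trans (ιbar-between (4 + n) lower upper) (m+n∸n≡m x (2 * Fib (2 + n)))
  where
  lower : Fib (4 + n) < x + 2 * Fib (2 + n)
  lower = subst (_< x + 2 * Fib (2 + n)) (Fib[1+n]+2*Fib[2+n]≡Fib[4+n] n) (+-monoˡ-< (2 * Fib (2 + n)) F<x)
  upper : x + 2 * Fib (2 + n) < Fib (5 + n)
  upper = subst (x + 2 * Fib (2 + n) <_) (Fib[3+n]+Fib[1+n]+2*Fib[2+n]≡Fib[5+n] n) (+-monoˡ-< (2 * Fib (2 + n)) x<c)

α-shift : ∀ n x → x ≤ Fib (3 + n) + Fib (1 + n) →
  x ≤α x + 2 * Fib (2 + n) × (¬ InFbar x → x ≢ Fib (3 + n) + Fib (1 + n) → x ≡α x + 2 * Fib (2 + n))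

α-shift-below : ∀ n x → x < Fib (1 + n) →
  x ≤α x + 2 * Fib (2 + n) × (¬ InFbar x → x ≡α x + 2 * Fib (2 + n))
α-shift-below n             zero    _         = (λ α0 _ → ≤-trans (αbarIs-≤ α0) z≤n) , λ 0∉F → ⊥-elim (0∉F (0 , refl))
α-shift-below zero          (suc _) (s≤s ())
α-shift-below (suc zero)    (suc _) (s≤s ())
α-shift-below (suc (suc n)) x@(suc _) x<F =
  let (x≤αz , x≡αz) = α-shift n x (≤-trans (<⇒≤ x<F) (m≤m+n _ _))
  in ≤α-ιbarʳ ιy≡z x≤αz , λ x∉F → ≡α-ιbarʳ ιy≡z (x≡αz x∉F x≢c)
  where
  ιy≡z : ιbar (x + 2 * Fib (4 + n)) ≡ x + 2 * Fib (2 + n)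
  ιy≡z = ιbar-shift-below (2 + n) (s≤s z≤n) x<F
  x≢c : x ≢ Fib (3 + n) + Fib (1 + n)
  x≢c x≡c = <⇒≱ x<F (≤-trans (m≤m+n _ _) (≤-reflexive (sym x≡c)))

α-shift n x x≤c with <-cmp x (Fib (1 + n))
... | tri< x<F _ _ = let (x≤αy , x≡αy) = α-shift-below n x x<F in x≤αy , λ x∉F _ → x≡αy x∉F
... | tri≈ _ x≡F _ =
  ≤α-Fib (4 + n) (trans (cong (_+ 2 * Fib (2 + n)) x≡F) (Fib[1+n]+2*Fib[2+n]≡Fib[4+n] n)) (m≤m+n x _) ,
  λ x∉F _ → ⊥-elim (x∉F (1 + n , sym x≡F))
... | tri> _ _ F<x with m≤n⇒m<n∨m≡n x≤c
...   | inj₁ x<c = ≡α⇒≤α x≡αy , λ _ _ → x≡αy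
  where
  x≡αy : x ≡α x + 2 * Fib (2 + n)
  x≡αy = ≡α-ιbarʳ (ιbar-shift-above n F<x x<c) ≡α-refl
...   | inj₂ x≡c =
  ≤α-Fib (5 + n) (trans (cong (_+ 2 * Fib (2 + n)) x≡c) (Fib[3+n]+Fib[1+n]+2*Fib[2+n]≡Fib[5+n] n)) (m≤m+n x _) ,
  λ _ x≢c → ⊥-elim (x≢c x≡c)

lemma4p5 : ∀ (k' : ℕ) → let k = 3 + k' in
    ∀ (x : ℕ) → x ≤ Fib k + Fib (1 + k') →
    ∀ (a b : ℕ) → αbarIs x a → αbarIs (x + 2 * Fib (2 + k')) b →
      (a ≤ b) × ((¬ InFbar x → ¬ x ≡ Fib k + Fib (1 + k') → a ≡ b))
lemma4p5 k' x x≤c a b αx αy =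
  let (x≤αy , x≡αy) = α-shift k' x x≤c in x≤αy αx αy , λ x∉F x≢c → x≡αy x∉F x≢c αx αy
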